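{- Let $t$ be a $\rhd\mathsf{shuf}$-normal term. (1) If $\pi$ is a derivation with conclusion $\vdash t\colon\mathbf{0}$ (empty environment) and $\pi'$ is a derivation with conclusion $\Gamma\vdash t\colon\mathbf{0}$, then $t$ is a value, $|\pi|=0$, $\mathrm{Dom}(\Gamma)=\emptyset$ and $\pi=\pi'$. More precisely, $\pi$ consists of a single rule (ax) if $t$ is a variable; otherwise $t$ is an abstraction and $\pi$ consists of a single $0$-ary rule ($\lambda$). (2) Given a list $\vec{x}=(x_1,\dots,x_k)$ of pairwise distinct variables with $\mathrm{Fv}(t)\subseteq\{x_1,\dots,x_k\}$, the following are equivalent: (a) $t$ is a value; (b) $((\mathbf{0},\dots,\mathbf{0}),\mathbf{0})\in[\![t]\!]_{\vec{x}}$ (with $k$ copies of $\mathbf{0}$); (c) there is a derivation with conclusion $\vdash t\colon\mathbf{0}$; (d) there is a derivation $\pi$ with subject $t$ such that $|\pi|=0$.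
   Context: Terms: $t ::= x \mid \lambda x.t \mid tu$ (up to $\alpha$); values $v ::= x \mid \lambda x.t$; $\mathrm{Fv}(t)$ free variables; $t\{v/x\}$ substitution. Root steps: ($\beta_v$) $(\lambda x.t)v \mapsto t\{v/x\}$, $v$ a value; ($\sigma_1$) $(\lambda x.t)us \mapsto (\lambda x.ts)u$ if $x\notin\mathrm{Fv}(s)$; ($\sigma_3$) $v((\lambda x.s)u)\mapsto(\lambda x.vs)u$ if $v$ a value, $x\notin\mathrm{Fv}(v)$. Balanced contexts $B ::= [\cdot] \mid (\lambda x.B)t \mid Bt \mid tB$; $\rhd\mathsf{shuf}$-reduction is the closure of the union of the root steps under balanced contexts; normal means no step applies. Types: positive types are finite multisets $[(P_1,Q_1),\dots,(P_n,Q_n)]$ of pairs of positive types ($\mathbf{0}$ empty, $\uplus$ union). Environments map variables to positive types; $\mathrm{Dom}(\Gamma)=\{x\mid\Gamma(x)\neq\mathbf{0}\}$ (finite); combined pointwise by $\uplus$. Rules: (ax) $x\colon P\vdash x\colon P$; ($\lambda$) from $\Gamma_i,x\colon P_i\vdash t\colon Q_i$ ($1\le i\le n$, $n\ge0$) infer $\biguplus_i\Gamma_i\vdash\lambda x.t\colon[(P_1,Q_1),\dots,(P_n,Q_n)]$; ($@$) from $\Gamma\vdash t\colon[(P,Q)]$ and $\Delta\vdash u\colon P$ infer $\Gamma\uplus\Delta\vdash tu\colon Q$. A derivation has subject $t$ if its conclusion is of the form $\Gamma\vdash t\colon Q$. The size $|\pi|$ is the number of $@$ rules. Relational semantics: $[\![t]\!]_{\vec{x}}=\{((P_1,\dots,P_k),Q)\mid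 x_1\colon P_1,\dots,x_k\colon P_k\vdash t\colon Q\text{ derivable}\}$. -}

module Defs where

open import Data.Nat using (ℕ; zero; suc; _+_)
open import Data.Fin using (Fin; zero; suc)
open import Data.List using (List; []; _∷_; _++_)
open import Data.List.Relation.Binary.Permutation.Propositional using (_↭_)
open import Data.Vec using (Vec; []; _∷_; replicate; zipWith; _[_]≔_)
open import Data.Vec.Relation.Binary.Pointwise.Inductive using () renaming (Pointwise to VPointwise)
open import Data.Product using (Σ; _×_; _,_; ∃)
open import Relation.Nullary using (¬_)

-- Terms up to α: well-scoped de Bruijn terms.  Term n has its free
-- variables among the n variables 0 … n-1 (de Bruijn indices).

data Term (n : ℕ) : Set where
  var : Fin n → Term n
  lam : Term (suc n) → Term n
  app : Term n → Term n → Term n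

data IsValue {n : ℕ} : Term n → Set where
  var-val : (i : Fin n) → IsValue (var i)
  lam-val : (t : Term (suc n)) → IsValue (lam t)

ext : ∀ {m n} → (Fin m → Fin n) → Fin (suc m) → Fin (suc n)
ext ρ zero    = zero
ext ρ (suc i) = suc (ρ i)

rename : ∀ {m n} → (Fin m → Fin n) → Term m → Term n
rename ρ (var i)   = var (ρ i)
rename ρ (lam t)   = lam (rename (ext ρ) t)
rename ρ (app t u) = app (rename ρ t) (rename ρ u)

weaken : ∀ {n} → Term n → Term (suc n)
weaken = rename suc

exts : ∀ {m n} → (Fin m → Term n) → Fin (suc m) → Term (suc n)
exts σ zero    = var zero
exts σ (suc i) = weaken (σ i)

tsubst : ∀ {m n} → (Fin m → Term n) → Term m → Term n
tsubst σ (var i)   = σ i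
tsubst σ (lam t)   = lam (tsubst (exts σ) t)
tsubst σ (app t u) = app (tsubst σ t) (tsubst σ u)

_[_/0] : ∀ {n} → Term (suc n) → Term n → Term n
t [ v /0] = tsubst σ t
  where
    σ : _ → _
    σ zero    = v
    σ (suc i) = var i

-- Root steps (β_v, σ_1, σ_3).  The side conditions x ∉ Fv(s), x ∉ Fv(v)
-- are rendered by weakening s resp. v under the new binder.

data _↦_ {n : ℕ} : Term n → Term n → Set where
  βv : ∀ (t : Term (suc n)) (v : Term n) → IsValue v →
       app (lam t) v ↦ (t [ v /0])
  σ1 : ∀ (t : Term (suc n)) (u s : Term n) →
       app (app (lam t) u) s ↦ app (lam (app t (weaken s))) u
  σ3 : ∀ (v : Term n) (s : Term (suc n)) (u : Term n) → IsValue v →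
       app v (app (lam s) u) ↦ app (lam (app (weaken v) s)) u

data _⇒shuf_ : {n : ℕ} → Term n → Term n → Set where
  root  : ∀ {n} {t t' : Term n} → t ↦ t' → t ⇒shuf t'
  inLam : ∀ {n} {t t' : Term (suc n)} (u : Term n) →
          t ⇒shuf t' → app (lam t) u ⇒shuf app (lam t') u
  appL  : ∀ {n} {t t' : Term n} (u : Term n) →
          t ⇒shuf t' → app t u ⇒shuf app t' u
  appR  : ∀ {n} (t : Term n) {u u' : Term n} →
          u ⇒shuf u' → app t u ⇒shuf app t u'

ShufNormal : ∀ {n} → Term n → Set
ShufNormal t = ∀ t' → ¬ (t ⇒shuf t')

-- Positive types: finite multisets of pairs of positive types,
-- represented by lists, with multiset equality _≈_ (up to permutation,
-- recursively).

data Pos : Set where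
  mk : List (Pos × Pos) → Pos

𝟘 : Pos
𝟘 = mk []

_⊎ₚ_ : Pos → Pos → Pos
mk xs ⊎ₚ mk ys = mk (xs ++ ys)

mutual
  data _≈_ : Pos → Pos → Set where
    mk≈ : ∀ {xs ys zs} → PW xs zs → zs ↭ ys → mk xs ≈ mk ys

  data PW : List (Pos × Pos) → List (Pos × Pos) → Set where
    []  : PW [] []
    cons : ∀ {P P' Q Q' xs ys} → P ≈ P' → Q ≈ Q' → PW xs ys →
           PW ((P , Q) ∷ xs) ((P' , Q') ∷ ys)

-- environments for Term n: a positive type for each of the n variables
-- (all other variables are implicitly mapped to 𝟘)
Env : ℕ → Set
Env n = Vec Pos n

emptyEnv : ∀ {n} → Env n
emptyEnv {n} = replicate n 𝟘

_⊎ₑ_ : ∀ {n} → Env n → Env n → Env n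
_⊎ₑ_ = zipWith _⊎ₚ_

DomEmpty : ∀ {n} → Env n → Set
DomEmpty {n} Γ = VPointwise _≈_ Γ (emptyEnv {n})

-- The (λ) rule has a list of n ≥ 0 premises,
-- collected in LDer.  Since types are list representatives of multisets,
-- the (@) rule matches the argument type up to multiset equality.

mutual
  data Der : {n : ℕ} → Env n → Term n → Pos → Set where
    ax  : ∀ {n} (i : Fin n) (P : Pos) →
          Der (emptyEnv [ i ]≔ P) (var i) P
    lamR : ∀ {n} {Γ : Env n} {t : Term (suc n)} {R : List (Pos × Pos)} →
          LDer Γ t R → Der Γ (lam t) (mk R)
    appR : ∀ {n} {Γ Δ : Env n} {t u : Term n} {P P' Q : Pos} →
          Der Γ t (mk ((P , Q) ∷ [])) → Der Δ u P' → P ≈ P' →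
          Der (Γ ⊎ₑ Δ) (app t u) Q

  data LDer : {n : ℕ} → Env n → Term (suc n) → List (Pos × Pos) → Set where
    lnil  : ∀ {n} {t : Term (suc n)} → LDer emptyEnv t []
    lcons : ∀ {n} {Γ₁ Γ₂ : Env n} {t : Term (suc n)} {P Q R} →
            Der (P ∷ Γ₁) t Q → LDer Γ₂ t R →
            LDer (Γ₁ ⊎ₑ Γ₂) t ((P , Q) ∷ R)

mutual
  size : ∀ {n Γ} {t : Term n} {Q} → Der Γ t Q → ℕ
  size (ax i P)      = 0
  size (lamR ls)     = lsize ls
  size (appR d e _)  = suc (size d + size e)

  lsize : ∀ {n Γ} {t : Term (suc n)} {R} → LDer Γ t R → ℕ
  lsize lnil         = 0
  lsize (lcons d ls) = size d + lsize ls

data SingleAx : ∀ {n Γ} {t : Term n} {Q} → Der Γ t Q → Set where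
  single-ax : ∀ {n} (i : Fin n) (P : Pos) → SingleAx (ax i P)

data SingleLam0 : ∀ {n Γ} {t : Term n} {Q} → Der Γ t Q → Set where
  single-lam0 : ∀ {n} {t : Term (suc n)} → SingleLam0 (lamR (lnil {n} {t}))

-- Relational semantics ⟦t⟧_x⃗ for t : Term k, x⃗ = the k variables of
-- the scope: (P⃗ , Q) ∈ ⟦t⟧ iff x₁:P₁,…,x_k:P_k ⊢ t : Q is derivable
-- (up to multiset equality of the types).

⟦_⟧∋_,_ : ∀ {k} → Term k → Vec Pos k → Pos → Set
⟦ t ⟧∋ Ps , Q =
  Σ (Env _) λ Γ → Σ Pos λ Q' →
    Der Γ t Q' × VPointwise _≈_ Γ Ps × Q' ≈ Q

-- Typed with the empty environment, a variable has type 𝟘, so it cannot be the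
-- head of an application; an abstraction applied to a value is a βv-redex.
-- Hence a normal application typed with the empty environment would have a
-- strictly smaller application typed with the empty environment (the head or
-- the argument), which is absurd: normal terms typable in the empty
-- environment are values (only βv-normality is needed). Conversely a value has a unique derivation of type
-- 𝟘, namely the single axiom or the single 0-ary abstraction, and only values
-- have derivations without (@) rules.
module Submission where

open import Defs
open import Data.Nat using (zero; suc)
open import Data.Product using (Σ; _×_; _,_; proj₁; proj₂)
open import Data.Sum using (_⊎_; inj₁; inj₂)
open import Data.Vec using (replicate; []; _∷_; lookup; _[_]≔_)
open import Data.Vec.Properties using (∷-injective; lookup∘update; lookup-replicate; []≔-lookup)
open import Data.Vec.Relation.Binary.Pointwise.Inductive using ([]; _∷_)
open import Data.Fin using (Fin)
open import Data.List using (List)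
open import Data.List.Properties using (++-conicalˡ; ++-conicalʳ)
open import Data.List.Relation.Binary.Permutation.Propositional using (↭-refl)
open import Data.List.Relation.Binary.Permutation.Propositional.Properties using (↭-empty-inv)
open import Data.Empty using (⊥)
open import Function.Bundles using (_⇔_; mk⇔)
open import Relation.Binary.PropositionalEquality using (_≡_; refl; sym; cong; subst; module ≡-Reasoning)

mk-injective : ∀ {xs ys : List (Pos × Pos)} → mk xs ≡ mk ys → xs ≡ ys
mk-injective refl = refl

⊎ₚ-conical : ∀ (P Q : Pos) → P ⊎ₚ Q ≡ 𝟘 → P ≡ 𝟘 × Q ≡ 𝟘
⊎ₚ-conical (mk xs) (mk ys) eq
  rewrite ++-conicalˡ xs ys (mk-injective eq) | ++-conicalʳ xs ys (mk-injective eq) = refl , refl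

⊎ₑ-conical : ∀ {n} (Γ Δ : Env n) → Γ ⊎ₑ Δ ≡ emptyEnv → Γ ≡ emptyEnv × Δ ≡ emptyEnv
⊎ₑ-conical []      []      _  = refl , refl
⊎ₑ-conical (P ∷ Γ) (Q ∷ Δ) eq with ∷-injective eq
... | eq₀ , eqs with ⊎ₚ-conical P Q eq₀ | ⊎ₑ-conical Γ Δ eqs
...   | refl , refl | refl , refl = refl , refl

emptyEnv-[]≔𝟘 : ∀ {n} (i : Fin n) → emptyEnv [ i ]≔ 𝟘 ≡ emptyEnv
emptyEnv-[]≔𝟘 i = begin
  emptyEnv [ i ]≔ 𝟘                   ≡⟨ cong (emptyEnv [ i ]≔_) (sym (lookup-replicate i 𝟘)) ⟩
  emptyEnv [ i ]≔ lookup emptyEnv i   ≡⟨ []≔-lookup emptyEnv i ⟩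
  emptyEnv                            ∎
  where open ≡-Reasoning

𝟘≈𝟘 : 𝟘 ≈ 𝟘
𝟘≈𝟘 = mk≈ [] ↭-refl

≈𝟘⇒≡𝟘 : ∀ {P} → P ≈ 𝟘 → P ≡ 𝟘
≈𝟘⇒≡𝟘 (mk≈ pw p) with ↭-empty-inv p
≈𝟘⇒≡𝟘 (mk≈ [] p) | refl = refl

DomEmpty-emptyEnv : ∀ {n} → DomEmpty (emptyEnv {n})
DomEmpty-emptyEnv {zero}  = []
DomEmpty-emptyEnv {suc n} = 𝟘≈𝟘 ∷ DomEmpty-emptyEnv

DomEmpty⇒≡emptyEnv : ∀ {n} {Γ : Env n} → DomEmpty Γ → Γ ≡ emptyEnv
DomEmpty⇒≡emptyEnv []       = refl
DomEmpty⇒≡emptyEnv (p ∷ ps) with ≈𝟘⇒≡𝟘 p | DomEmpty⇒≡emptyEnv ps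
... | refl | refl = refl

≡emptyEnv⇒DomEmpty : ∀ {n} {Γ : Env n} → Γ ≡ emptyEnv → DomEmpty Γ
≡emptyEnv⇒DomEmpty refl = DomEmpty-emptyEnv

var-type-emptyEnv : ∀ {n} {Γ : Env n} {i P} → Der Γ (var i) P → Γ ≡ emptyEnv → P ≡ 𝟘
var-type-emptyEnv (ax i P) eq = begin
  P                            ≡⟨ sym (lookup∘update i emptyEnv P) ⟩
  lookup (emptyEnv [ i ]≔ P) i ≡⟨ cong (λ Γ → lookup Γ i) eq ⟩
  lookup emptyEnv i            ≡⟨ lookup-replicate i 𝟘 ⟩
  𝟘                            ∎
  where open ≡-Reasoning

normal-app-untypable-emptyEnv : ∀ {n} {Γ : Env n} {a b Q} →
  ShufNormal (app a b) → Der Γ (app a b) Q → Γ ≡ emptyEnv → ⊥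
normal-app-untypable-emptyEnv {a = var i} nf (appR {Γ = Γ₁} {Δ₁} π _ _) eq
  with () ← var-type-emptyEnv π (proj₁ (⊎ₑ-conical Γ₁ Δ₁ eq))
normal-app-untypable-emptyEnv {a = app a₁ a₂} {b} nf (appR {Γ = Γ₁} {Δ₁} π _ _) eq =
  normal-app-untypable-emptyEnv (λ t' r → nf (app t' b) (appL b r)) π (proj₁ (⊎ₑ-conical Γ₁ Δ₁ eq))
normal-app-untypable-emptyEnv {a = lam s} {var j}  nf _ _ = nf _ (root (βv s (var j) (var-val j)))
normal-app-untypable-emptyEnv {a = lam s} {lam s'} nf _ _ = nf _ (root (βv s (lam s') (lam-val s')))
normal-app-untypable-emptyEnv {a = lam s} {app b₁ b₂} nf (appR {Γ = Γ₁} {Δ₁} _ ρ _) eq =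
  normal-app-untypable-emptyEnv (λ t' r → nf (app (lam s) t') (appR (lam s) r)) ρ (proj₂ (⊎ₑ-conical Γ₁ Δ₁ eq))

normal-typable-emptyEnv⇒value : ∀ {n} (t : Term n) → ShufNormal t →
  ∀ {Γ Q} → Der Γ t Q → Γ ≡ emptyEnv → IsValue t
normal-typable-emptyEnv⇒value (var i)   _  _ _  = var-val i
normal-typable-emptyEnv⇒value (lam s)   _  _ _  = lam-val s
normal-typable-emptyEnv⇒value (app a b) nf π eq with () ← normal-app-untypable-emptyEnv nf π eq

size≡0⇒value : ∀ {n} (t : Term n) {Γ Q} (π : Der Γ t Q) → size π ≡ 0 → IsValue t
size≡0⇒value (var i) _ _ = var-val i
size≡0⇒value (lam s) _ _ = lam-val s
size≡0⇒value (app a b) (appR _ _ _) ()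

value-𝟘-derivation : ∀ {n} {t : Term n} → IsValue t → Der emptyEnv t 𝟘
value-𝟘-derivation (var-val i) = subst (λ Γ → Der Γ (var i) 𝟘) (emptyEnv-[]≔𝟘 i) (ax i 𝟘)
value-𝟘-derivation (lam-val s) = lamR lnil

value-𝟘-env : ∀ {n} {t : Term n} → IsValue t → ∀ {Γ} → Der Γ t 𝟘 → Γ ≡ emptyEnv
value-𝟘-env (var-val i) (ax i _)    = emptyEnv-[]≔𝟘 i
value-𝟘-env (lam-val s) (lamR lnil) = refl

value-𝟘-unique : ∀ {n} {t : Term n} → IsValue t → ∀ {Γ Γ'}
  (π : Der Γ t 𝟘) (π' : Der Γ' t 𝟘) (eq : Γ' ≡ Γ) → subst (λ Δ → Der Δ t 𝟘) eq π' ≡ π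
value-𝟘-unique (var-val i) (ax i _)    (ax i _)    refl = refl
value-𝟘-unique (lam-val s) (lamR lnil) (lamR lnil) refl = refl

value-𝟘-single : ∀ {n} {t : Term n} → IsValue t → ∀ {Γ}
  (π : Der Γ t 𝟘) → SingleAx π ⊎ SingleLam0 π
value-𝟘-single (var-val i) (ax i _)    = inj₁ (single-ax i 𝟘)
value-𝟘-single (lam-val s) (lamR lnil) = inj₂ single-lam0

single⇒size≡0 : ∀ {n Γ} {t : Term n} {Q} {π : Der Γ t Q} → SingleAx π ⊎ SingleLam0 π → size π ≡ 0
single⇒size≡0 (inj₁ (single-ax i P)) = refl
single⇒size≡0 (inj₂ single-lam0)     = refl

normal-emptyEnv-𝟘-derivation : ∀ {n} (t : Term n) → ShufNormal t →
  (π : Der emptyEnv t 𝟘) (Γ : Env n) (π' : Der Γ t 𝟘) →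
  IsValue t × size π ≡ 0 × DomEmpty Γ
  × Σ (Γ ≡ emptyEnv) (λ eq → subst (λ Δ → Der Δ t 𝟘) eq π' ≡ π)
  × (SingleAx π ⊎ SingleLam0 π)
normal-emptyEnv-𝟘-derivation t nf π Γ π' =
  v , single⇒size≡0 single , ≡emptyEnv⇒DomEmpty eq , (eq , value-𝟘-unique v π π' eq) , single
  where
    v : IsValue t
    v = normal-typable-emptyEnv⇒value t nf π refl
    eq : Γ ≡ emptyEnv
    eq = value-𝟘-env v π'
    single : SingleAx π ⊎ SingleLam0 π
    single = value-𝟘-single v π

mainTheorem14 : ∀ {n} (t : Term n) → ShufNormal t →
    ((π : Der emptyEnv t 𝟘) → (Γ : Env n) → (π' : Der Γ t 𝟘) →
    IsValue t × size π ≡ 0 × DomEmpty Γ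
    × Σ (Γ ≡ emptyEnv) (λ eq → subst (λ Δ → Der Δ t 𝟘) eq π' ≡ π)
    × (SingleAx π ⊎ SingleLam0 π))
    × ((IsValue t ⇔ (⟦ t ⟧∋ replicate n 𝟘 , 𝟘))
    × (IsValue t ⇔ Der emptyEnv t 𝟘)
    × (IsValue t ⇔ Σ (Env n) (λ Γ → Σ Pos (λ Q → Σ (Der Γ t Q) (λ π → size π ≡ 0)))))
mainTheorem14 t nf =
    normal-emptyEnv-𝟘-derivation t nf
  , mk⇔ (λ v → emptyEnv , 𝟘 , value-𝟘-derivation v , DomEmpty-emptyEnv , 𝟘≈𝟘)
        (λ { (_ , _ , π , dom , _) → value π (DomEmpty⇒≡emptyEnv dom) })
  , mk⇔ value-𝟘-derivation (λ π → value π refl)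
  , mk⇔ (λ v → emptyEnv , 𝟘 , value-𝟘-derivation v
             , single⇒size≡0 (value-𝟘-single v (value-𝟘-derivation v)))
        (λ { (_ , _ , π , size≡0) → size≡0⇒value t π size≡0 })
  where
    value : ∀ {Γ Q} → Der Γ t Q → Γ ≡ emptyEnv → IsValue t
    value = normal-typable-emptyEnv⇒value t nf
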